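{- Consider an instance of fair $k$-center: a finite metric space $(X,d)$, a group assignment $g:X\to\{1,\dots,m\}$, capacities $k_1,\dots,k_m$ with $k=\sum_jk_j$, and $\mathrm{OPT}$ the minimum clustering cost for $X$ of a feasible set; let $\tau\ge\mathrm{OPT}$. Let $X$ be partitioned among $\ell$ processors into $X_1,\dots,X_\ell$, each of size at least $k+1$. Each processor $i$ computes: $p^i_1\in X_i$ arbitrary; for $j=2,\dots,k+1$, $p^i_j\in\arg\max_{p\in X_i}\min_{1\le j'<j}d(p,p^i_{j'})$; $P_i=\{p^i_1,\dots,p^i_k\}$; $r_i=\min_{1\le j'\le k}d(p^i_{k+1},p^i_{j'})/2$; for each $p\in P_i$, a set $L(p)$ obtained by initializing $L(p)=\{p\}$ and scanning $X_i$ in an arbitrary order, adding a scanned $x$ whenever $d(p,x)\le2r_i$ and $L(p)$ has no point of group $g(x)$ yet; and $L_i=\bigcup_{p\in P_i}L(p)$; it sends $(P_i,L_i)$ to a coordinator. The coordinator sets $X'=\bigcup_iP_i$, $L=\bigcup_iL_i$, and: (1) computes $P\subseteq X'$ by scanning $X'$ in an arbitrary order, starting with $P$ containing the first point and adding a scanned $q$ whenever $\min_{p\in P}d(p,q)>10\tau$; (2) for each $q\in P$, initializes $N(q)=\{q\}$ and scans $L$ in an arbitrary order, adding a scanned $x$ to $N(q)$ whenever $d(q,x)\le5\tau$ and $N(q)$ has no point of group $g(x)$ yet; (3) outputs a feasible set $S\subseteq\bigcup_{q\in P}N(q)$ intersecting the maximum possible number of the sets $N(q)$, $q\in P$, among all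 feasible subsets of $\bigcup_{q\in P}N(q)$. Then $S$ is feasible and its clustering cost for $X$ is at most $17\tau$. In particular, if $\tau\in[\mathrm{OPT},(1+\varepsilon)\mathrm{OPT}]$ then $S$ is a $17(1+\varepsilon)$-approximation.
   Context: For nonempty $A,B\subseteq X$, the clustering cost of $A$ for $B$ is $\max_{b\in B}\min_{a\in A}d(a,b)$. A set $S\subseteq X$ is feasible if for every group $j$ it contains at most $k_j$ points of group $j$. The fair $k$-center problem asks for a feasible set of minimum clustering cost for $X$, whose value is $\mathrm{OPT}$. Each processor can only compute distances between its own points; the coordinator can compute distances among the points it receives.
   Formalization: The distances of the metric d and the estimate τ take rational values instead of real ones. -}

module Defs where

open import Data.Nat as ℕ using (ℕ; zero; suc; _∸_)
open import Data.Fin as Fin using (Fin; _≟_)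
open import Data.Fin.Subset using (Subset; _∈_; ⁅_⁆; _∪_; _∩_; _⊆_; ∣_∣; Nonempty) renaming (⊥ to ∅)
open import Data.Fin.Subset.Properties using (nonempty?; _∈?_)
open import Data.Integer using (+_)
open import Data.Rational using (ℚ; 0ℚ; ½; _⊓_; _/_; _+_; _*_; _<_) renaming (_≤_ to _≤ℚ_)
open import Data.Rational.Properties using (_≤?_; _<?_)
open import Data.List using (List; []; _∷_; [_]; _++_; map; allFin; upTo; filter; concatMap; length; foldr)
open import Data.List.Relation.Unary.All using (all?)
open import Data.List.Relation.Unary.Any using (Any; any?)
open import Data.List.Relation.Binary.Permutation.Propositional using (_↭_)
open import Data.Vec using (tabulate)
open import Data.Nat.ListAction using (sum)
open import Data.Product using (Σ; _×_)
open import Relation.Nullary using (yes; no; ⌊_⌋)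
open import Relation.Binary.PropositionalEquality using (_≡_)

record IsMetric {n : ℕ} (d : Fin n → Fin n → ℚ) : Set where
  field
    dist-self : ∀ x → d x x ≡ 0ℚ
    dist-sep  : ∀ x y → d x y ≡ 0ℚ → x ≡ y
    dist-sym  : ∀ x y → d x y ≡ d y x
    dist-tri  : ∀ x y z → d x z ≤ℚ d x y + d y z

ℚ[_] : ℕ → ℚ
ℚ[ a ] = + a / 1

minUpTo : ℕ → (ℕ → ℚ) → ℚ
minUpTo zero    f = f 0
minUpTo (suc m) f = minUpTo m f ⊓ f (suc m)

module Fair {n m : ℕ} (d : Fin n → Fin n → ℚ) (g : Fin n → Fin m) (k : Fin m → ℕ) where

  K : ℕ
  K = sum (map k (allFin m))

  group : Fin m → Subset n
  group j = tabulate (λ x → ⌊ g x ≟ j ⌋)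

  Feasible : Subset n → Set
  Feasible S = ∀ j → ∣ S ∩ group j ∣ ℕ.≤ k j

  CostAtMost : Subset n → Subset n → ℚ → Set
  CostAtMost A B r = ∀ b → b ∈ B → Σ (Fin n) λ a → a ∈ A × d a b ≤ℚ r

  -- τ ≥ OPT : some feasible set has clustering cost for X at most τ
  -- (OPT is a minimum over the finitely many feasible sets)
  OPT≤ : ℚ → Set
  OPT≤ τ = Σ (Subset n) λ S → Feasible S × CostAtMost S Data.Fin.Subset.⊤ τ

  enum : Subset n → List (Fin n)
  enum S = filter (_∈? S) (allFin n)

  toSub : List (Fin n) → Subset n
  toSub = foldr (λ x s → ⁅ x ⁆ ∪ s) ∅

  groupScan : Fin n → ℚ → List (Fin n) → List (Fin n) → List (Fin n)
  groupScan c R acc [] = acc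
  groupScan c R acc (x ∷ xs) with d c x ≤? R | any? (λ y → g y ≟ g x) acc
  ... | yes _ | no _ = groupScan c R (acc ++ [ x ]) xs
  ... | _     | _    = groupScan c R acc xs

  farScan : ℚ → List (Fin n) → List (Fin n) → List (Fin n)
  farScan R acc [] = acc
  farScan R acc (q ∷ qs) with all? (λ p → R <? d p q) acc
  ... | yes _ = farScan R (acc ++ [ q ]) qs
  ... | no _  = farScan R acc qs

  coordP : ℚ → List (Fin n) → List (Fin n)
  coordP R []       = []
  coordP R (q ∷ qs) = farScan R [ q ] qs

  module _ {ℓ : ℕ} (part : Fin n → Fin ℓ) where

    block : Fin ℓ → Subset n
    block i = tabulate (λ x → ⌊ part x ≟ i ⌋)

    -- A run of processor i (all arbitrary choices are fields).
    -- pt j is p^i_{j+1}  (0-indexed), j = 0 .. K.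
    record LocalRun (i : Fin ℓ) : Set where
      field
        pt     : ℕ → Fin n
        pt-in  : ∀ j → j ℕ.≤ K → pt j ∈ block i
        pt-max : ∀ j → j ℕ.< K → ∀ p → p ∈ block i →
                 minUpTo j (λ j' → d p (pt j')) ≤ℚ minUpTo j (λ j' → d (pt (suc j)) (pt j'))
        order      : Fin n → List (Fin n)
        order-perm : ∀ p → order p ↭ enum (block i)

      Pᵢ : List (Fin n)
      Pᵢ = map pt (upTo K)

      rᵢ : ℚ
      rᵢ = ½ * minUpTo (K ∸ 1) (λ j' → d (pt K) (pt j'))

      L : Fin n → List (Fin n)
      L p = groupScan p (ℚ[ 2 ] * rᵢ) [ p ] (order p)

      Lᵢ : List (Fin n)
      Lᵢ = concatMap L Pᵢ

    module _ (runs : (i : Fin ℓ) → LocalRun i) where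

      X' : Subset n
      X' = toSub (concatMap (λ i → LocalRun.Pᵢ (runs i)) (allFin ℓ))

      Lall : Subset n
      Lall = toSub (concatMap (λ i → LocalRun.Lᵢ (runs i)) (allFin ℓ))

      -- A run of the coordinator with parameter τ (arbitrary choices are fields).
      record CoordRun (τ : ℚ) : Set where
        field
          ordX      : List (Fin n)
          ordX-perm : ordX ↭ enum X'
          ordL      : Fin n → List (Fin n)
          ordL-perm : ∀ q → ordL q ↭ enum Lall

        Pc : List (Fin n)
        Pc = coordP (ℚ[ 10 ] * τ) ordX

        N : Fin n → List (Fin n)
        N q = groupScan q (ℚ[ 5 ] * τ) [ q ] (ordL q)

        U : Subset n
        U = toSub (concatMap N Pc)

        hits : Subset n → ℕ
        hits T = length (filter (λ q → nonempty? (T ∩ toSub (N q))) Pc)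

        field
          S          : Subset n
          S-feasible : Feasible S
          S-sub      : S ⊆ U
          S-max      : ∀ T → Feasible T → T ⊆ U → hits T ℕ.≤ hits S

{-# OPTIONS --safe #-}
module Submission where

-- Fix a feasible S* of cost at most τ and send every point x to a centre c(x) ∈ S* with
-- d(c(x), x) ≤ τ.  Points more than 2τ apart have distinct centres, so a 2τ-separated set
-- has at most k points, and at most k_j of them whose centre lies in group j.
-- The k+1 greedy points of processor i are 2r_i-separated, hence 2r_i ≤ 2τ, and by the
-- farthest-first choice every point of X_i lies within 2r_i of P_i; so L contains, for
-- every x, a point of x's group within 4τ of x.  The points of P are 10τ-separated and
-- each N(q) contains a point of the group of c(q) (found within τ + 4τ of q); choosing one
-- per q gives a feasible set meeting every N(q), so by maximality S meets every N(q).
-- A point x is within 2τ of some p ∈ X′, p within 10τ of some q ∈ P, and q within 5τ of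
-- a point of S ∩ N(q): 17τ in all.

open import Defs
open import Data.Empty using (⊥-elim)
open import Data.Fin using (Fin; _≟_)
open import Data.Fin.Subset using (Subset; inside; outside; ⁅_⁆; _∈_; _∩_; _∪_; _⊆_; _-_; ⋃; ∣_∣; ⊤; Nonempty)
open import Data.Fin.Subset.Properties
  using (∈⊤; ∉⊥; ∣⊥∣≡0; x∈⁅x⁆; x∈⁅y⁆⇒x≡y; ∣⁅x⁆∣≡1; ⊆-trans; p⊆q⇒∣p∣≤∣q∣; x∈p∩q⁺; x∈p∩q⁻;
         p⊆p∪q; q⊆p∪q; x∈p∪q⁻; x∈p∧x≢y⇒x∈p-y; x∈p⇒∣p-x∣<∣p∣; nonempty?; _∈?_)
open import Data.List using (List; []; _∷_; [_]; _++_; map; filter; length; concatMap; allFin; upTo; applyDownFrom)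
open import Data.List.Properties using (length-map; length-applyDownFrom; filter-all; filter-notAll)
open import Data.List.Membership.Propositional using (find; lose) renaming (_∈_ to _∈ₗ_)
open import Data.List.Membership.Propositional.Properties
  using (∈-++⁺ˡ; ∈-++⁺ʳ; ∈-map⁺; ∈-map⁻; ∈-filter⁺; ∈-filter⁻; ∈-allFin; ∈-upTo⁺; ∈-concatMap⁺)
open import Data.List.Relation.Unary.All as All using (All; []; _∷_)
import Data.List.Relation.Unary.All.Properties as Allₚ
open import Data.List.Relation.Unary.AllPairs as AllPairs using (AllPairs; []; _∷_)
import Data.List.Relation.Unary.AllPairs.Properties as AllPairsₚ
open import Data.List.Relation.Unary.Any using (here; there; any?)
open import Data.List.Relation.Unary.Unique.Propositional using (Unique)
open import Data.List.Relation.Binary.Permutation.Propositional using (_↭_; ↭-sym)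
open import Data.List.Relation.Binary.Permutation.Propositional.Properties using (∈-resp-↭)
open import Data.Nat as ℕ using (ℕ; zero; suc; _≤_; _<_; z≤n; s≤s; s≤s⁻¹; _∸_; _≤′_; ≤′-refl; ≤′-step)
import Data.Nat.Properties as ℕₚ
open import Data.Nat.ListAction using (sum)
open import Data.Product using (∃-syntax; _×_; _,_; proj₁; proj₂)
open import Data.Rational using (ℚ; 0ℚ; ½; _+_; _*_; nonNegative) renaming (_≤_ to _≤ℚ_; _<_ to _<ℚ_)
import Data.Rational.Properties as ℚₚ
open import Data.Sum using (inj₁; inj₂)
open import Data.Vec using ([]; _∷_; tabulate)
open import Data.Vec.Properties using (lookup∘tabulate; lookup⇒[]=; []=⇒lookup)
open import Relation.Binary.PropositionalEquality using (_≡_; _≢_; ≢-sym; refl; sym; trans; cong; subst; module ≡-Reasoning)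
open import Relation.Nullary using (Dec; yes; no; ⌊_⌋)
open import Relation.Nullary.Decidable using (isYes≗does; dec-true)

variable
  n m : ℕ

∣p∪q∣≤∣p∣+∣q∣ : (p q : Subset n) → ∣ p ∪ q ∣ ≤ ∣ p ∣ ℕ.+ ∣ q ∣
∣p∪q∣≤∣p∣+∣q∣ []            []            = z≤n
∣p∪q∣≤∣p∣+∣q∣ (outside ∷ p) (outside ∷ q) = ∣p∪q∣≤∣p∣+∣q∣ p q
∣p∪q∣≤∣p∣+∣q∣ (outside ∷ p) (inside ∷ q)  =
  ℕₚ.≤-trans (s≤s (∣p∪q∣≤∣p∣+∣q∣ p q)) (ℕₚ.≤-reflexive (sym (ℕₚ.+-suc ∣ p ∣ ∣ q ∣)))
∣p∪q∣≤∣p∣+∣q∣ (inside ∷ p)  (outside ∷ q) = s≤s (∣p∪q∣≤∣p∣+∣q∣ p q)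
∣p∪q∣≤∣p∣+∣q∣ (inside ∷ p)  (inside ∷ q)  =
  s≤s (ℕₚ.≤-trans (∣p∪q∣≤∣p∣+∣q∣ p q) (ℕₚ.+-monoʳ-≤ ∣ p ∣ (ℕₚ.n≤1+n ∣ q ∣)))

∣⋃∣≤∑ : {A : Set} (f : A → Subset n) (b : A → ℕ) → (∀ a → ∣ f a ∣ ≤ b a) →
        (as : List A) → ∣ ⋃ (map f as) ∣ ≤ sum (map b as)
∣⋃∣≤∑ {n} f b ∣f∣≤b []       = ℕₚ.≤-reflexive (∣⊥∣≡0 n)
∣⋃∣≤∑ f b ∣f∣≤b (a ∷ as) =
  ℕₚ.≤-trans (∣p∪q∣≤∣p∣+∣q∣ (f a) _) (ℕₚ.+-mono-≤ (∣f∣≤b a) (∣⋃∣≤∑ f b ∣f∣≤b as))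

⊆⋃ : {p : Subset n} {ps : List (Subset n)} → p ∈ₗ ps → p ⊆ ⋃ ps
⊆⋃ {ps = q ∷ ps} (here refl) = p⊆p∪q (⋃ ps)
⊆⋃ {ps = q ∷ ps} (there p∈ps) = ⊆-trans (⊆⋃ p∈ps) (q⊆p∪q q (⋃ ps))

length≤∣p∣ : {p : Subset n} {xs : List (Fin n)} → Unique xs → All (_∈ p) xs → length xs ≤ ∣ p ∣
length≤∣p∣ [] [] = z≤n
length≤∣p∣ {p = p} {x ∷ xs} (x∉xs ∷ unique) (x∈p ∷ xs⊆p) =
  ℕₚ.≤-trans (s≤s (length≤∣p∣ unique xs⊆p-x)) (x∈p⇒∣p-x∣<∣p∣ x∈p)
  where
  xs⊆p-x : All (_∈ p - x) xs
  xs⊆p-x = All.zipWith (λ (x≢y , y∈p) → x∈p∧x≢y⇒x∈p-y y∈p (≢-sym x≢y)) (x∉xs , xs⊆p)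

fibre : (Fin n → Fin m) → Fin m → Subset n
fibre f j = tabulate (λ x → ⌊ f x ≟ j ⌋)

∈-fibre⁺ : (f : Fin n → Fin m) {x : Fin n} {j : Fin m} → f x ≡ j → x ∈ fibre f j
∈-fibre⁺ f {x} refl =
  lookup⇒[]= x _ (trans (lookup∘tabulate _ x) (trans (isYes≗does (f x ≟ f x)) (dec-true (f x ≟ f x) refl)))

∈-fibre⁻ : (f : Fin n → Fin m) {x : Fin n} {j : Fin m} → x ∈ fibre f j → f x ≡ j
∈-fibre⁻ f {x} {j} x∈ with f x ≟ j | trans (sym (lookup∘tabulate (λ y → ⌊ f y ≟ j ⌋) x)) ([]=⇒lookup x∈)
... | yes fx≡j | _ = fx≡j
... | no _     | ()

minUpTo-≤ : ∀ j (f : ℕ → ℚ) {a} → a ≤ j → minUpTo j f ≤ℚ f a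
minUpTo-≤ zero    f z≤n = ℚₚ.≤-refl
minUpTo-≤ (suc j) f a≤1+j with ℕₚ.m≤n⇒m<n∨m≡n a≤1+j
... | inj₁ (s≤s a≤j) = ℚₚ.≤-trans (ℚₚ.p⊓q≤p (minUpTo j f) (f (suc j))) (minUpTo-≤ j f a≤j)
... | inj₂ refl      = ℚₚ.p⊓q≤q (minUpTo j f) (f (suc j))

minUpTo-attained : ∀ j (f : ℕ → ℚ) → ∃[ a ] a ≤ j × minUpTo j f ≡ f a
minUpTo-attained zero    f = 0 , z≤n , refl
minUpTo-attained (suc j) f with ℚₚ.⊓-sel (minUpTo j f) (f (suc j))
... | inj₂ min≡last = suc j , ℕₚ.≤-refl , min≡last
... | inj₁ min≡prev with minUpTo-attained j f
...   | a , a≤j , min≡fa = a , ℕₚ.m≤n⇒m≤1+n a≤j , trans min≡prev min≡fa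

module FairKCenter {d : Fin n → Fin n → ℚ} (metric : IsMetric d) (g : Fin n → Fin m) (k : Fin m → ℕ) where
  open Fair d g k
  open IsMetric metric

  ∈-toSub⁺ : ∀ {x xs} → x ∈ₗ xs → x ∈ toSub xs
  ∈-toSub⁺ {xs = y ∷ ys} (here refl) = p⊆p∪q (toSub ys) (x∈⁅x⁆ y)
  ∈-toSub⁺ {xs = y ∷ ys} (there x∈) = q⊆p∪q _ (toSub ys) (∈-toSub⁺ x∈)

  ∈-toSub⁻ : ∀ {x} xs → x ∈ toSub xs → x ∈ₗ xs
  ∈-toSub⁻ []       x∈ = ⊥-elim (∉⊥ x∈)
  ∈-toSub⁻ (y ∷ ys) x∈ with x∈p∪q⁻ _ (toSub ys) x∈
  ... | inj₁ x∈⁅y⁆ = here (x∈⁅y⁆⇒x≡y y x∈⁅y⁆)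
  ... | inj₂ x∈ys  = there (∈-toSub⁻ ys x∈ys)

  ∣toSub∣≤length : ∀ xs → ∣ toSub xs ∣ ≤ length xs
  ∣toSub∣≤length []       = ℕₚ.≤-reflexive (∣⊥∣≡0 n)
  ∣toSub∣≤length (x ∷ xs) = ℕₚ.≤-trans (∣p∪q∣≤∣p∣+∣q∣ ⁅ x ⁆ (toSub xs))
    (ℕₚ.≤-trans (ℕₚ.≤-reflexive (cong (ℕ._+ ∣ toSub xs ∣) (∣⁅x⁆∣≡1 x))) (s≤s (∣toSub∣≤length xs)))

  ∈-ordered : ∀ {S x xs} → xs ↭ enum S → x ∈ S → x ∈ₗ xs
  ∈-ordered {S} xs↭S x∈S = ∈-resp-↭ (↭-sym xs↭S) (∈-filter⁺ (_∈? S) (∈-allFin _) x∈S)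

  ∈-block-part : ∀ {ℓ} (part : Fin n → Fin ℓ) x → x ∈ block part (part x)
  ∈-block-part part x = ∈-fibre⁺ part refl

  ∈-gathered : ∀ {ℓ} (f : Fin ℓ → List (Fin n)) {i x} → x ∈ₗ f i → x ∈ toSub (concatMap f (allFin ℓ))
  ∈-gathered f {i} x∈ = ∈-toSub⁺ (∈-concatMap⁺ f (lose (∈-allFin i) x∈))

  Feasible⇒∣S∣≤K : ∀ S → Feasible S → ∣ S ∣ ≤ K
  Feasible⇒∣S∣≤K S feasible =
    ℕₚ.≤-trans (p⊆q⇒∣p∣≤∣q∣ S⊆⋃groups) (∣⋃∣≤∑ (λ j → S ∩ group j) k feasible (allFin m))
    where
    S⊆⋃groups : S ⊆ ⋃ (map (λ j → S ∩ group j) (allFin m))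
    S⊆⋃groups {x} x∈S =
      ⊆⋃ (∈-map⁺ (λ j → S ∩ group j) (∈-allFin (g x))) (x∈p∩q⁺ (x∈S , ∈-fibre⁺ g refl))

  dist-nonneg : ∀ x y → 0ℚ ≤ℚ d x y
  dist-nonneg x y with 0ℚ ℚₚ.≤? d x y
  ... | yes 0≤d = 0≤d
  ... | no 0≰d  = ⊥-elim (ℚₚ.<-irrefl refl (ℚₚ.≤-<-trans 0≤d+d (ℚₚ.+-mono-< d<0 d<0)))
    where
    d<0 : d x y <ℚ 0ℚ
    d<0 = ℚₚ.≰⇒> 0≰d
    0≤d+d : 0ℚ ≤ℚ d x y + d x y
    0≤d+d = ℚₚ.≤-trans (ℚₚ.≤-reflexive (sym (dist-self x)))
              (ℚₚ.≤-trans (dist-tri x y x) (ℚₚ.≤-reflexive (cong (d x y +_) (dist-sym y x))))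

  dist-via : ∀ {x z} y → d x z ≤ℚ d y x + d y z
  dist-via {x} {z} y = ℚₚ.≤-trans (dist-tri x y z) (ℚₚ.≤-reflexive (cong (_+ d y z) (dist-sym x y)))

  dist-self≤ : ∀ x {R} → 0ℚ ≤ℚ R → d x x ≤ℚ R
  dist-self≤ x 0≤R = ℚₚ.≤-trans (ℚₚ.≤-reflexive (dist-self x)) 0≤R

  groupScan-⊇ : ∀ c R acc xs {y} → y ∈ₗ acc → y ∈ₗ groupScan c R acc xs
  groupScan-⊇ c R acc []       y∈ = y∈
  groupScan-⊇ c R acc (x ∷ xs) y∈ with d c x ℚₚ.≤? R | any? (λ y → g y ≟ g x) acc
  ... | yes _ | no _  = groupScan-⊇ c R (acc ++ [ x ]) xs (∈-++⁺ˡ y∈)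
  ... | yes _ | yes _ = groupScan-⊇ c R acc xs y∈
  ... | no _  | _     = groupScan-⊇ c R acc xs y∈

  groupScan-within : ∀ c R acc xs → All (λ y → d c y ≤ℚ R) acc → All (λ y → d c y ≤ℚ R) (groupScan c R acc xs)
  groupScan-within c R acc []       acc-within = acc-within
  groupScan-within c R acc (x ∷ xs) acc-within with d c x ℚₚ.≤? R | any? (λ y → g y ≟ g x) acc
  ... | yes dcx≤R | no _ = groupScan-within c R (acc ++ [ x ]) xs (Allₚ.++⁺ acc-within (dcx≤R ∷ []))
  ... | yes _ | yes _    = groupScan-within c R acc xs acc-within
  ... | no _  | _        = groupScan-within c R acc xs acc-within

  groupScan-within-centre : ∀ c R xs → 0ℚ ≤ℚ R → All (λ y → d c y ≤ℚ R) (groupScan c R [ c ] xs)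
  groupScan-within-centre c R xs 0≤R =
    groupScan-within c R [ c ] xs (dist-self≤ c 0≤R ∷ [])

  groupScan-meets-group : ∀ c R acc {x} xs → x ∈ₗ xs → d c x ≤ℚ R → ∃[ y ] y ∈ₗ groupScan c R acc xs × g y ≡ g x
  groupScan-meets-group c R acc (x ∷ xs) (here refl) dcx≤R with d c x ℚₚ.≤? R | any? (λ y → g y ≟ g x) acc
  ... | yes _ | no _        = x , groupScan-⊇ c R (acc ++ [ x ]) xs (∈-++⁺ʳ acc (here refl)) , refl
  ... | yes _ | yes met     = let (y , y∈acc , gy≡gx) = find met in y , groupScan-⊇ c R acc xs y∈acc , gy≡gx
  ... | no dcx≰R | _        = ⊥-elim (dcx≰R dcx≤R)
  groupScan-meets-group c R acc (x ∷ xs) (there x′∈xs) dcx′≤R with d c x ℚₚ.≤? R | any? (λ y → g y ≟ g x) acc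
  ... | yes _ | no _  = groupScan-meets-group c R (acc ++ [ x ]) xs x′∈xs dcx′≤R
  ... | yes _ | yes _ = groupScan-meets-group c R acc xs x′∈xs dcx′≤R
  ... | no _  | _     = groupScan-meets-group c R acc xs x′∈xs dcx′≤R

  farScan-⊇ : ∀ R acc qs {p} → p ∈ₗ acc → p ∈ₗ farScan R acc qs
  farScan-⊇ R acc []       p∈ = p∈
  farScan-⊇ R acc (q ∷ qs) p∈ with All.all? (λ p → R ℚₚ.<? d p q) acc
  ... | yes _ = farScan-⊇ R (acc ++ [ q ]) qs (∈-++⁺ˡ p∈)
  ... | no _  = farScan-⊇ R acc qs p∈

  farScan-separated : ∀ R acc qs → AllPairs (λ p q → R <ℚ d p q) acc →
                      AllPairs (λ p q → R <ℚ d p q) (farScan R acc qs)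
  farScan-separated R acc []       separated = separated
  farScan-separated R acc (q ∷ qs) separated with All.all? (λ p → R ℚₚ.<? d p q) acc
  ... | yes far = farScan-separated R (acc ++ [ q ]) qs
                    (AllPairsₚ.++⁺ separated ([] ∷ []) (All.map (_∷ []) far))
  ... | no _    = farScan-separated R acc qs separated

  farScan-covers : ∀ R acc {q} qs → 0ℚ ≤ℚ R → q ∈ₗ qs → ∃[ p ] p ∈ₗ farScan R acc qs × d p q ≤ℚ R
  farScan-covers R acc (q ∷ qs) 0≤R (here refl) with All.all? (λ p → R ℚₚ.<? d p q) acc
  ... | yes _   = q , farScan-⊇ R (acc ++ [ q ]) qs (∈-++⁺ʳ acc (here refl)) , dist-self≤ q 0≤R
  ... | no near = let (p , p∈acc , R≮dpq) = find (Allₚ.¬All⇒Any¬ (λ p → R ℚₚ.<? d p q) acc near)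
                  in p , farScan-⊇ R acc qs p∈acc , ℚₚ.≮⇒≥ R≮dpq
  farScan-covers R acc (q ∷ qs) 0≤R (there q′∈qs) with All.all? (λ p → R ℚₚ.<? d p q) acc
  ... | yes _ = farScan-covers R (acc ++ [ q ]) qs 0≤R q′∈qs
  ... | no _  = farScan-covers R acc qs 0≤R q′∈qs

  coordP-separated : ∀ R qs → AllPairs (λ p q → R <ℚ d p q) (coordP R qs)
  coordP-separated R []       = []
  coordP-separated R (q ∷ qs) = farScan-separated R [ q ] qs ([] ∷ [])

  coordP-covers : ∀ R {q} qs → 0ℚ ≤ℚ R → q ∈ₗ qs → ∃[ p ] p ∈ₗ coordP R qs × d p q ≤ℚ R
  coordP-covers R (q ∷ qs) 0≤R (here refl)   = q , farScan-⊇ R [ q ] qs (here refl) , dist-self≤ q 0≤R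
  coordP-covers R (q ∷ qs) 0≤R (there q′∈qs) = farScan-covers R [ q ] qs 0≤R q′∈qs

  module Optimum {τ : ℚ} (S* : Subset n) (S*-feasible : Feasible S*) (S*-covers : CostAtMost S* ⊤ τ) where

    centre : Fin n → Fin n
    centre x = proj₁ (S*-covers x ∈⊤)

    centre-∈ : ∀ x → centre x ∈ S*
    centre-∈ x = proj₁ (proj₂ (S*-covers x ∈⊤))

    -- Radii are written ℚ[ a ] * τ throughout: sums of them are combined by *-distribʳ-+,
    -- after which closed numerals such as ℚ[ 1 ] + ℚ[ 4 ] and ℚ[ 5 ] agree by computation.
    centre-dist : ∀ x → d (centre x) x ≤ℚ ℚ[ 1 ] * τ
    centre-dist x = ℚₚ.≤-trans (proj₂ (proj₂ (S*-covers x ∈⊤))) (ℚₚ.≤-reflexive (sym (ℚₚ.*-identityˡ τ)))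

    τ-nonneg : Fin n → 0ℚ ≤ℚ τ
    τ-nonneg x = ℚₚ.≤-trans (dist-nonneg (centre x) x) (proj₂ (proj₂ (S*-covers x ∈⊤)))

    centre-injective : ∀ {x y} → ℚ[ 2 ] * τ <ℚ d x y → centre x ≢ centre y
    centre-injective {x} {y} 2τ<dxy cx≡cy = ℚₚ.<-irrefl refl (ℚₚ.<-≤-trans 2τ<dxy dxy≤2τ)
      where
      open ℚₚ.≤-Reasoning
      dxy≤2τ : d x y ≤ℚ ℚ[ 2 ] * τ
      dxy≤2τ = begin
        d x y                                    ≤⟨ dist-via (centre x) ⟩
        d (centre x) x + d (centre x) y          ≡⟨ cong (λ c → d (centre x) x + d c y) cx≡cy ⟩
        d (centre x) x + d (centre y) y          ≤⟨ ℚₚ.+-mono-≤ (centre-dist x) (centre-dist y) ⟩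
        ℚ[ 1 ] * τ + ℚ[ 1 ] * τ                  ≡⟨ ℚₚ.*-distribʳ-+ τ ℚ[ 1 ] ℚ[ 1 ] ⟨
        ℚ[ 2 ] * τ                               ∎

    separated-length≤ : ∀ {A xs} → AllPairs (λ x y → ℚ[ 2 ] * τ <ℚ d x y) xs → All (λ x → centre x ∈ A) xs →
                        length xs ≤ ∣ A ∣
    separated-length≤ {xs = xs} separated centres∈A = ℕₚ.≤-trans
      (ℕₚ.≤-reflexive (sym (length-map centre xs)))
      (length≤∣p∣ (AllPairsₚ.map⁺ (AllPairs.map centre-injective separated)) (Allₚ.map⁺ centres∈A))

    separated-length≤K : ∀ {xs} → AllPairs (λ x y → ℚ[ 2 ] * τ <ℚ d x y) xs → length xs ≤ K
    separated-length≤K separated =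
      ℕₚ.≤-trans (separated-length≤ separated (All.tabulate (λ _ → centre-∈ _))) (Feasible⇒∣S∣≤K S* S*-feasible)

    K-positive : Fin n → 0 < K
    K-positive x = separated-length≤K {xs = [ x ]} ([] ∷ [])

    module Greedy {ℓ : ℕ} {part : Fin n → Fin ℓ} {i : Fin ℓ} (run : LocalRun part i) where
      open LocalRun run

      gap : ℕ → ℚ
      gap j = minUpTo j (λ j′ → d (pt (suc j)) (pt j′))

      gap-step : ∀ {j} → suc j < K → gap (suc j) ≤ℚ gap j
      gap-step {j} 1+j<K = ℚₚ.≤-trans
        (ℚₚ.p⊓q≤p (minUpTo j (λ j′ → d (pt (suc (suc j))) (pt j′))) _)
        (pt-max j (ℕₚ.<⇒≤ 1+j<K) (pt (suc (suc j))) (pt-in (suc (suc j)) 1+j<K))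

      gap-antitone : ∀ {a b} → a ≤′ b → b < K → gap b ≤ℚ gap a
      gap-antitone ≤′-refl         _     = ℚₚ.≤-refl
      gap-antitone (≤′-step a≤′b) 1+b<K = ℚₚ.≤-trans (gap-step 1+b<K) (gap-antitone a≤′b (ℕₚ.<⇒≤ 1+b<K))

      last : ℕ
      last = K ∸ 1

      1+last≡K : suc last ≡ K
      1+last≡K = trans (ℕₚ.+-comm 1 last) (ℕₚ.m∸n+n≡m (K-positive (pt 0)))

      last<K : last < K
      last<K = ℕₚ.≤-reflexive 1+last≡K

      gap-separates : ∀ {a b} → a < b → b ≤ K → gap last ≤ℚ d (pt b) (pt a)
      gap-separates {a} {suc b} (s≤s a≤b) 1+b≤K = ℚₚ.≤-trans
        (gap-antitone (ℕₚ.≤⇒≤′ (ℕₚ.∸-monoˡ-≤ 1 1+b≤K)) last<K)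
        (minUpTo-≤ b (λ j′ → d (pt (suc b)) (pt j′)) a≤b)

      gap-covers : ∀ {x} → x ∈ block part i → ∃[ a ] a < K × d (pt a) x ≤ℚ gap last
      gap-covers {x} x∈Xᵢ with minUpTo-attained last (λ a → d x (pt a))
      ... | a , a≤last , min≡dx = a , ℕₚ.≤-<-trans a≤last last<K , (begin
        d (pt a) x                        ≡⟨ dist-sym (pt a) x ⟩
        d x (pt a)                        ≡⟨ min≡dx ⟨
        minUpTo last (λ a → d x (pt a))   ≤⟨ pt-max last last<K x x∈Xᵢ ⟩
        gap last                          ∎)
        where open ℚₚ.≤-Reasoning

      gap≤2τ : gap last ≤ℚ ℚ[ 2 ] * τ
      gap≤2τ with gap last ℚₚ.≤? ℚ[ 2 ] * τ
      ... | yes gap≤2τ = gap≤2τ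
      ... | no gap≰2τ  = ⊥-elim (ℕₚ.<-irrefl refl
            (subst (_≤ K) (length-applyDownFrom pt (suc K)) (separated-length≤K greedy-separated)))
        where
        greedy-separated : AllPairs (λ x y → ℚ[ 2 ] * τ <ℚ d x y) (applyDownFrom pt (suc K))
        greedy-separated = AllPairsₚ.applyDownFrom⁺₁ pt (suc K)
          (λ b<a a<1+K → ℚₚ.<-≤-trans (ℚₚ.≰⇒> gap≰2τ) (gap-separates b<a (s≤s⁻¹ a<1+K)))

      2rᵢ≡gap : ℚ[ 2 ] * rᵢ ≡ gap last
      2rᵢ≡gap = begin
        ℚ[ 2 ] * (½ * M)      ≡⟨ ℚₚ.*-assoc ℚ[ 2 ] ½ M ⟨
        (ℚ[ 2 ] * ½) * M      ≡⟨ ℚₚ.*-identityˡ M ⟩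
        M                     ≡⟨ cong (λ b → minUpTo last (λ j′ → d (pt b) (pt j′))) 1+last≡K ⟨
        gap last              ∎
        where
        open ≡-Reasoning
        M : ℚ
        M = minUpTo last (λ j′ → d (pt K) (pt j′))

      2rᵢ≤2τ : ℚ[ 2 ] * rᵢ ≤ℚ ℚ[ 2 ] * τ
      2rᵢ≤2τ = ℚₚ.≤-trans (ℚₚ.≤-reflexive 2rᵢ≡gap) gap≤2τ

      Pᵢ-covers : ∀ {x} → x ∈ block part i → ∃[ p ] p ∈ₗ Pᵢ × d p x ≤ℚ ℚ[ 2 ] * rᵢ
      Pᵢ-covers x∈Xᵢ with gap-covers x∈Xᵢ
      ... | a , a<K , dax≤gap = pt a , ∈-map⁺ pt (∈-upTo⁺ a<K) , ℚₚ.≤-trans dax≤gap (ℚₚ.≤-reflexive (sym 2rᵢ≡gap))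

      Lᵢ-represents : ∀ {x} → x ∈ block part i → ∃[ y ] y ∈ₗ Lᵢ × g y ≡ g x × d x y ≤ℚ ℚ[ 4 ] * τ
      Lᵢ-represents {x} x∈Xᵢ =
        let p , p∈Pᵢ , dpx≤2rᵢ = Pᵢ-covers x∈Xᵢ
            y , y∈Lp , gy≡gx = groupScan-meets-group p (ℚ[ 2 ] * rᵢ) [ p ] (order p)
                                 (∈-ordered (order-perm p) x∈Xᵢ) dpx≤2rᵢ
            dpy≤2rᵢ = All.lookup (groupScan-within-centre p (ℚ[ 2 ] * rᵢ) (order p)
                                   (ℚₚ.≤-trans (dist-nonneg p x) dpx≤2rᵢ)) y∈Lp
        in y , ∈-concatMap⁺ L (lose p∈Pᵢ y∈Lp) , gy≡gx , (begin
          d x y                          ≤⟨ dist-via p ⟩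
          d p x + d p y                  ≤⟨ ℚₚ.+-mono-≤ (ℚₚ.≤-trans dpx≤2rᵢ 2rᵢ≤2τ) (ℚₚ.≤-trans dpy≤2rᵢ 2rᵢ≤2τ) ⟩
          ℚ[ 2 ] * τ + ℚ[ 2 ] * τ        ≡⟨ ℚₚ.*-distribʳ-+ τ ℚ[ 2 ] ℚ[ 2 ] ⟨
          ℚ[ 4 ] * τ                     ∎)
        where open ℚₚ.≤-Reasoning

    module Distributed {ℓ : ℕ} {part : Fin n → Fin ℓ} (runs : (i : Fin ℓ) → LocalRun part i) where

      X′-covers : ∀ x → ∃[ p ] p ∈ X' part runs × d p x ≤ℚ ℚ[ 2 ] * τ
      X′-covers x =
        let p , p∈Pᵢ , dpx≤2rᵢ = Greedy.Pᵢ-covers (runs (part x)) (∈-block-part part x)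
        in p , ∈-gathered (λ i → LocalRun.Pᵢ (runs i)) p∈Pᵢ , ℚₚ.≤-trans dpx≤2rᵢ (Greedy.2rᵢ≤2τ (runs (part x)))

      L-represents : ∀ x → ∃[ y ] y ∈ Lall part runs × g y ≡ g x × d x y ≤ℚ ℚ[ 4 ] * τ
      L-represents x =
        let y , y∈Lᵢ , gy≡gx , dxy≤4τ = Greedy.Lᵢ-represents (runs (part x)) (∈-block-part part x)
        in y , ∈-gathered (λ i → LocalRun.Lᵢ (runs i)) y∈Lᵢ , gy≡gx , dxy≤4τ

      module Coordinator (c : CoordRun part runs τ) (τ≥0 : 0ℚ ≤ℚ τ) where
        open CoordRun c

        scale-mono : ∀ {p q} → p ≤ℚ q → p * τ ≤ℚ q * τ
        scale-mono = ℚₚ.*-monoʳ-≤-nonNeg τ {{nonNegative τ≥0}}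

        0≤5τ : 0ℚ ≤ℚ ℚ[ 5 ] * τ
        0≤5τ = subst (_≤ℚ ℚ[ 5 ] * τ) (ℚₚ.*-zeroˡ τ) (scale-mono (ℚₚ.≤ᵇ⇒≤ {0ℚ} {ℚ[ 5 ]} _))

        0≤10τ : 0ℚ ≤ℚ ℚ[ 10 ] * τ
        0≤10τ = subst (_≤ℚ ℚ[ 10 ] * τ) (ℚₚ.*-zeroˡ τ) (scale-mono (ℚₚ.≤ᵇ⇒≤ {0ℚ} {ℚ[ 10 ]} _))

        2τ≤10τ : ℚ[ 2 ] * τ ≤ℚ ℚ[ 10 ] * τ
        2τ≤10τ = scale-mono (ℚₚ.≤ᵇ⇒≤ {ℚ[ 2 ]} {ℚ[ 10 ]} _)

        N-meets-centre-group : ∀ q → ∃[ z ] z ∈ₗ N q × g z ≡ g (centre q)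
        N-meets-centre-group q =
          let y , y∈L , gy≡go , doy≤4τ = L-represents (centre q)
              z , z∈Nq , gz≡gy = groupScan-meets-group q (ℚ[ 5 ] * τ) [ q ] (ordL q)
                                   (∈-ordered (ordL-perm q) y∈L) (close-to-centre doy≤4τ)
          in z , z∈Nq , trans gz≡gy gy≡go
          where
          open ℚₚ.≤-Reasoning
          close-to-centre : ∀ {y} → d (centre q) y ≤ℚ ℚ[ 4 ] * τ → d q y ≤ℚ ℚ[ 5 ] * τ
          close-to-centre {y} doy≤4τ = begin
            d q y                              ≤⟨ dist-via (centre q) ⟩
            d (centre q) q + d (centre q) y    ≤⟨ ℚₚ.+-mono-≤ (centre-dist q) doy≤4τ ⟩
            ℚ[ 1 ] * τ + ℚ[ 4 ] * τ            ≡⟨ ℚₚ.*-distribʳ-+ τ ℚ[ 1 ] ℚ[ 4 ] ⟨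
            ℚ[ 5 ] * τ                         ∎

        representative : Fin n → Fin n
        representative q = proj₁ (N-meets-centre-group q)

        representative-∈ : ∀ q → representative q ∈ₗ N q
        representative-∈ q = proj₁ (proj₂ (N-meets-centre-group q))

        representative-group : ∀ q → g (representative q) ≡ g (centre q)
        representative-group q = proj₂ (proj₂ (N-meets-centre-group q))

        Pc-separated : AllPairs (λ p q → ℚ[ 2 ] * τ <ℚ d p q) Pc
        Pc-separated = AllPairs.map (ℚₚ.≤-<-trans 2τ≤10τ) (coordP-separated (ℚ[ 10 ] * τ) ordX)

        T : Subset n
        T = toSub (map representative Pc)

        ∈-T⁻ : ∀ {x} → x ∈ T → ∃[ q ] q ∈ₗ Pc × x ≡ representative q
        ∈-T⁻ x∈T = ∈-map⁻ representative (∈-toSub⁻ (map representative Pc) x∈T)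

        T⊆U : T ⊆ U
        T⊆U x∈T =
          let q , q∈Pc , x≡rep = ∈-T⁻ x∈T
          in ∈-toSub⁺ (∈-concatMap⁺ N (lose q∈Pc (subst (_∈ₗ N q) (sym x≡rep) (representative-∈ q))))

        T-meets-all : ∀ {q} → q ∈ₗ Pc → Nonempty (T ∩ toSub (N q))
        T-meets-all {q} q∈Pc =
          representative q , x∈p∩q⁺ (∈-toSub⁺ (∈-map⁺ representative q∈Pc) , ∈-toSub⁺ (representative-∈ q))

        T-feasible : Feasible T
        T-feasible j = begin
          ∣ T ∩ group j ∣                     ≤⟨ p⊆q⇒∣p∣≤∣q∣ T∩group⊆ ⟩
          ∣ toSub (map representative F) ∣    ≤⟨ ∣toSub∣≤length (map representative F) ⟩
          length (map representative F)      ≡⟨ length-map representative F ⟩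
          length F                           ≤⟨ separated-length≤ (AllPairsₚ.filter⁺ has-j? Pc-separated) centres∈ ⟩
          ∣ S* ∩ group j ∣                    ≤⟨ S*-feasible j ⟩
          k j                                ∎
          where
          open ℕₚ.≤-Reasoning
          has-j? : ∀ q → Dec (g (centre q) ≡ j)
          has-j? q = g (centre q) ≟ j
          F : List (Fin n)
          F = filter has-j? Pc
          T∩group⊆ : T ∩ group j ⊆ toSub (map representative F)
          T∩group⊆ x∈ =
            let x∈T , x∈group = x∈p∩q⁻ T (group j) x∈
                q , q∈Pc , x≡rep = ∈-T⁻ x∈T
                g[centre]≡j = trans (sym (representative-group q)) (trans (cong g (sym x≡rep)) (∈-fibre⁻ g x∈group))
            in subst (_∈ toSub (map representative F)) (sym x≡rep)
                 (∈-toSub⁺ (∈-map⁺ representative (∈-filter⁺ has-j? q∈Pc g[centre]≡j)))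
          centres∈ : All (λ q → centre q ∈ S* ∩ group j) F
          centres∈ = All.tabulate (λ q∈F → x∈p∩q⁺ (centre-∈ _ , ∈-fibre⁺ g (proj₂ (∈-filter⁻ has-j? {xs = Pc} q∈F))))

        S-meets-all : ∀ {q} → q ∈ₗ Pc → Nonempty (S ∩ toSub (N q))
        S-meets-all {q} q∈Pc with nonempty? (S ∩ toSub (N q))
        ... | yes meets = meets
        ... | no misses = ⊥-elim (ℕₚ.<⇒≱ (filter-notAll _ Pc (lose q∈Pc misses)) ∣Pc∣≤hits[S])
          where
          ∣Pc∣≤hits[S] : length Pc ≤ hits S
          ∣Pc∣≤hits[S] = subst (_≤ hits S) (cong length (filter-all _ (All.tabulate T-meets-all)))
                           (S-max T T-feasible T⊆U)

        S-covers : ∀ b → ∃[ a ] a ∈ S × d a b ≤ℚ ℚ[ 17 ] * τ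
        S-covers b =
          let p , p∈X′ , dpb≤2τ = X′-covers b
              q , q∈Pc , dqp≤10τ = coordP-covers (ℚ[ 10 ] * τ) ordX 0≤10τ (∈-ordered ordX-perm p∈X′)
              z , z∈S∩Nq = S-meets-all q∈Pc
              z∈S , z∈Nq = x∈p∩q⁻ S (toSub (N q)) z∈S∩Nq
              dqz≤5τ : d q z ≤ℚ ℚ[ 5 ] * τ
              dqz≤5τ = All.lookup (groupScan-within-centre q (ℚ[ 5 ] * τ) (ordL q) 0≤5τ) (∈-toSub⁻ (N q) z∈Nq)
          in z , z∈S , (begin
            d z b                                        ≤⟨ dist-via q ⟩
            d q z + d q b                                ≤⟨ ℚₚ.+-mono-≤ dqz≤5τ (dist-tri q p b) ⟩
            ℚ[ 5 ] * τ + (d q p + d p b)                 ≤⟨ ℚₚ.+-monoʳ-≤ (ℚ[ 5 ] * τ) (ℚₚ.+-mono-≤ dqp≤10τ dpb≤2τ) ⟩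
            ℚ[ 5 ] * τ + (ℚ[ 10 ] * τ + ℚ[ 2 ] * τ)     ≡⟨ cong (ℚ[ 5 ] * τ +_) (ℚₚ.*-distribʳ-+ τ ℚ[ 10 ] ℚ[ 2 ]) ⟨
            ℚ[ 5 ] * τ + ℚ[ 12 ] * τ                     ≡⟨ ℚₚ.*-distribʳ-+ τ ℚ[ 5 ] ℚ[ 12 ] ⟨
            ℚ[ 17 ] * τ                                  ∎)
          where open ℚₚ.≤-Reasoning

theorem2 : {n m ℓ : ℕ} (d : Fin n → Fin n → ℚ) → IsMetric d →
           (g : Fin n → Fin m) (k : Fin m → ℕ) (τ : ℚ) →
           Fair.OPT≤ d g k τ →
           (part : Fin n → Fin ℓ) →
           (∀ i → suc (Fair.K d g k) ≤ ∣ Fair.block d g k part i ∣) →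
           (runs : (i : Fin ℓ) → Fair.LocalRun d g k part i) →
           (c : Fair.CoordRun d g k part runs τ) →
           Fair.Feasible d g k (Fair.CoordRun.S c)
             × Fair.CostAtMost d g k (Fair.CoordRun.S c) ⊤ (ℚ[ 17 ] * τ)
-- The size bound on the blocks only makes local runs possible.
theorem2 d metric g k τ (S* , S*-feasible , S*-covers) part _ runs c =
  CoordRun.S-feasible c , λ b _ → Coordinator.S-covers c (τ-nonneg b) b
  where
  open Fair d g k using (module CoordRun)
  open FairKCenter metric g k
  open Optimum S* S*-feasible S*-covers
  open Distributed runs
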